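{- Let $R\in\mathcal{R}$, $t\in R$ and $t\triangleright^* t'$. Then $t'\in R$.
   Context: There are two disjoint sets of variables: $\lambda$-variables $x,y,\dots$ and $\mu$-variables $a,b,\dots$. Terms $t$ and $\mathcal{E}$-terms $\varepsilon$ are given by $t ::= x \mid \lambda x.t \mid (t\;\varepsilon) \mid \langle t,t\rangle \mid \omega_1 t \mid \omega_2 t \mid \mu a.t \mid (a\;t)$, $\varepsilon ::= t \mid \pi_1 \mid \pi_2 \mid [x.t,y.t]$; $\mathcal{T}$ is the set of terms. One-step reduction $\triangleright$ is the closure under all contexts of the rules: $(\lambda x.u\;v)\triangleright u[x:=v]$; $(\langle t_1,t_2\rangle\;\pi_i)\triangleright t_i$; $(\omega_i t\;[x_1.u_1,x_2.u_2])\triangleright u_i[x_i:=t]$; $((t\;[x_1.u_1,x_2.u_2])\;\varepsilon)\triangleright (t\;[x_1.(u_1\;\varepsilon),x_2.(u_2\;\varepsilon)])$; $(\mu a.t\;\varepsilon)\triangleright \mu a.t[a:=^*\varepsilon]$, where $t[a:=^*\varepsilon]$ replaces inductively each subterm $(a\;v)$ of $t$ by $(a\;(v\;\varepsilon))$; $\triangleright^*$ is the reflexive–transitive closure. The paper considers only typed terms (typable in the natural-deduction system for classical propositional logic with $\perp,\to,\wedge,\vee$). $\mathcal{N}$ is the set of strongly normalizable terms (no infinite reduction sequence). For sets $K,L$ of terms: $K\to L=\{t\in\mathcal{T}:\ (t\;u)\in L \text{ for each } u\in K\}$; $K\wedge L=\{t:\ (t\;\pi_1)\in K,\ (t\;\pi_2)\in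 L\}$; $K\vee L=\{t:$ for all $\lambda$-variables $x,y$ and all $u,v\in\mathcal{N}$, if $u[x:=r]\in\mathcal{N}$ and $v[y:=s]\in\mathcal{N}$ for all $r\in K,s\in L$, then $(t\;[x.u,y.v])\in\mathcal{N}\}$. The set $\mathcal{R}$ of reducibility candidates is the smallest set of subsets of terms containing $\mathcal{N}$ and closed under $\to,\wedge,\vee$. -}

module Defs where

open import Data.Nat using (ℕ; zero; suc; _≟_)
open import Data.List using (List; _∷_)
open import Data.Product using (Σ; ∃; _×_; _,_)
open import Relation.Nullary using (yes; no)
open import Relation.Binary.PropositionalEquality using (_≡_)
open import Relation.Binary.Construct.Closure.ReflexiveTransitive using (Star)
open import Function using (id)

-- Syntax (de Bruijn indices; two disjoint index spaces:
-- λ-variables and μ-variables)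

mutual
  data Term : Set where
    var  : ℕ → Term
    lam  : Term → Term              -- λx.t   (binds λ-index 0)
    app  : Term → Elim → Term
    pair : Term → Term → Term
    inl  : Term → Term
    inr  : Term → Term
    mu   : Term → Term              -- μa.t   (binds μ-index 0)
    nam  : ℕ → Term → Term

  data Elim : Set where
    arg   : Term → Elim
    proj1 : Elim
    proj2 : Elim
    case  : Term → Term → Elim      -- [x.u , y.v] (each binds λ-index 0)

ext : (ℕ → ℕ) → ℕ → ℕ
ext ρ zero    = zero
ext ρ (suc n) = suc (ρ n)

mutual
  ren : (ℕ → ℕ) → (ℕ → ℕ) → Term → Term
  ren ρ σ (var x)    = var (ρ x)
  ren ρ σ (lam t)    = lam (ren (ext ρ) σ t)
  ren ρ σ (app t e)  = app (ren ρ σ t) (renE ρ σ e)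
  ren ρ σ (pair t u) = pair (ren ρ σ t) (ren ρ σ u)
  ren ρ σ (inl t)    = inl (ren ρ σ t)
  ren ρ σ (inr t)    = inr (ren ρ σ t)
  ren ρ σ (mu t)     = mu (ren ρ (ext σ) t)
  ren ρ σ (nam a t)  = nam (σ a) (ren ρ σ t)

  renE : (ℕ → ℕ) → (ℕ → ℕ) → Elim → Elim
  renE ρ σ (arg t)    = arg (ren ρ σ t)
  renE ρ σ proj1      = proj1
  renE ρ σ proj2      = proj2
  renE ρ σ (case u v) = case (ren (ext ρ) σ u) (ren (ext ρ) σ v)

exts : (ℕ → Term) → ℕ → Term
exts s zero    = var zero
exts s (suc n) = ren suc id (s n)

mshift : (ℕ → Term) → ℕ → Term
mshift s n = ren id suc (s n)

mutual
  sub : (ℕ → Term) → Term → Term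
  sub s (var x)    = s x
  sub s (lam t)    = lam (sub (exts s) t)
  sub s (app t e)  = app (sub s t) (subE s e)
  sub s (pair t u) = pair (sub s t) (sub s u)
  sub s (inl t)    = inl (sub s t)
  sub s (inr t)    = inr (sub s t)
  sub s (mu t)     = mu (sub (mshift s) t)
  sub s (nam a t)  = nam a (sub s t)

  subE : (ℕ → Term) → Elim → Elim
  subE s (arg t)    = arg (sub s t)
  subE s proj1      = proj1
  subE s proj2      = proj2
  subE s (case u v) = case (sub (exts s) u) (sub (exts s) v)

single : Term → ℕ → Term
single v zero    = v
single v (suc n) = var n

_[0:=_] : Term → Term → Term
u [0:= v ] = sub (single v) u

mutual
  msub : ℕ → Elim → Term → Term
  msub a e (var x)    = var x
  msub a e (lam t)    = lam (msub a (renE suc id e) t)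
  msub a e (app t f)  = app (msub a e t) (msubE a e f)
  msub a e (pair t u) = pair (msub a e t) (msub a e u)
  msub a e (inl t)    = inl (msub a e t)
  msub a e (inr t)    = inr (msub a e t)
  msub a e (mu t)     = mu (msub (suc a) (renE id suc e) t)
  msub a e (nam b t) with b ≟ a
  ... | yes _ = nam b (app (msub a e t) e)
  ... | no  _ = nam b (msub a e t)

  msubE : ℕ → Elim → Elim → Elim
  msubE a e (arg t)    = arg (msub a e t)
  msubE a e proj1      = proj1
  msubE a e proj2      = proj2
  msubE a e (case u v) = case (msub a (renE suc id e) u) (msub a (renE suc id e) v)

infix 4 _▷_ _▷E_
mutual
  data _▷_ : Term → Term → Set where
    β     : ∀ {u v} → app (lam u) (arg v) ▷ u [0:= v ]
    π₁β   : ∀ {t₁ t₂} → app (pair t₁ t₂) proj1 ▷ t₁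
    π₂β   : ∀ {t₁ t₂} → app (pair t₁ t₂) proj2 ▷ t₂
    ω₁β   : ∀ {t u₁ u₂} → app (inl t) (case u₁ u₂) ▷ u₁ [0:= t ]
    ω₂β   : ∀ {t u₁ u₂} → app (inr t) (case u₁ u₂) ▷ u₂ [0:= t ]
    comm  : ∀ {t u₁ u₂ e} →
            app (app t (case u₁ u₂)) e ▷
            app t (case (app u₁ (renE suc id e)) (app u₂ (renE suc id e)))
    μβ    : ∀ {t e} → app (mu t) e ▷ mu (msub zero (renE id suc e) t)
    ξlam  : ∀ {t t'} → t ▷ t' → lam t ▷ lam t'
    ξappl : ∀ {t t' e} → t ▷ t' → app t e ▷ app t' e
    ξappr : ∀ {t e e'} → e ▷E e' → app t e ▷ app t e'
    ξpairl : ∀ {t t' u} → t ▷ t' → pair t u ▷ pair t' u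
    ξpairr : ∀ {t u u'} → u ▷ u' → pair t u ▷ pair t u'
    ξinl  : ∀ {t t'} → t ▷ t' → inl t ▷ inl t'
    ξinr  : ∀ {t t'} → t ▷ t' → inr t ▷ inr t'
    ξmu   : ∀ {t t'} → t ▷ t' → mu t ▷ mu t'
    ξnam  : ∀ {a t t'} → t ▷ t' → nam a t ▷ nam a t'

  data _▷E_ : Elim → Elim → Set where
    ξarg   : ∀ {t t'} → t ▷ t' → arg t ▷E arg t'
    ξcasel : ∀ {u u' v} → u ▷ u' → case u v ▷E case u' v
    ξcaser : ∀ {u v v'} → v ▷ v' → case u v ▷E case u v'

infix 4 _▷*_
_▷*_ : Term → Term → Set
_▷*_ = Star _▷_

infixr 7 _⇒_
infixr 8 _∧_ _∨_
data Type : Set where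
  atom : ℕ → Type
  ⊥'   : Type
  _⇒_  : Type → Type → Type
  _∧_  : Type → Type → Type
  _∨_  : Type → Type → Type

data _∋_∶_ : List Type → ℕ → Type → Set where
  here  : ∀ {Γ A} → (A ∷ Γ) ∋ zero ∶ A
  there : ∀ {Γ A B n} → Γ ∋ n ∶ A → (B ∷ Γ) ∋ suc n ∶ A

infix 4 _∣_⊢_∶_ _∣_⊢E_▹_∶_
mutual
  data _∣_⊢_∶_ (Γ Δ : List Type) : Term → Type → Set where
    tvar  : ∀ {x A} → Γ ∋ x ∶ A → Γ ∣ Δ ⊢ var x ∶ A
    tlam  : ∀ {t A B} → (A ∷ Γ) ∣ Δ ⊢ t ∶ B → Γ ∣ Δ ⊢ lam t ∶ A ⇒ B
    tapp  : ∀ {t e A B} → Γ ∣ Δ ⊢ t ∶ A → Γ ∣ Δ ⊢E A ▹ e ∶ B → Γ ∣ Δ ⊢ app t e ∶ B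
    tpair : ∀ {t u A B} → Γ ∣ Δ ⊢ t ∶ A → Γ ∣ Δ ⊢ u ∶ B → Γ ∣ Δ ⊢ pair t u ∶ A ∧ B
    tinl  : ∀ {t A B} → Γ ∣ Δ ⊢ t ∶ A → Γ ∣ Δ ⊢ inl t ∶ A ∨ B
    tinr  : ∀ {t A B} → Γ ∣ Δ ⊢ t ∶ B → Γ ∣ Δ ⊢ inr t ∶ A ∨ B
    tmu   : ∀ {t A} → Γ ∣ (A ∷ Δ) ⊢ t ∶ ⊥' → Γ ∣ Δ ⊢ mu t ∶ A
    tnam  : ∀ {a t A} → Δ ∋ a ∶ A → Γ ∣ Δ ⊢ t ∶ A → Γ ∣ Δ ⊢ nam a t ∶ ⊥'

  -- eliminating a term of type A by e yields type B
  data _∣_⊢E_▹_∶_ (Γ Δ : List Type) : Type → Elim → Type → Set where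
    targ   : ∀ {u A B} → Γ ∣ Δ ⊢ u ∶ A → Γ ∣ Δ ⊢E A ⇒ B ▹ arg u ∶ B
    tproj1 : ∀ {A B} → Γ ∣ Δ ⊢E A ∧ B ▹ proj1 ∶ A
    tproj2 : ∀ {A B} → Γ ∣ Δ ⊢E A ∧ B ▹ proj2 ∶ B
    tcase  : ∀ {u v A B C} → (A ∷ Γ) ∣ Δ ⊢ u ∶ C → (B ∷ Γ) ∣ Δ ⊢ v ∶ C →
             Γ ∣ Δ ⊢E A ∨ B ▹ case u v ∶ C

𝒯 : Term → Set
𝒯 t = Σ (List Type) λ Γ → Σ (List Type) λ Δ → Σ Type λ A → Γ ∣ Δ ⊢ t ∶ A

data SN (t : Term) : Set where
  sn : (∀ {t'} → t ▷ t' → SN t') → SN t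

𝒩 : Term → Set
𝒩 t = 𝒯 t × SN t

TSet : Set₁
TSet = Term → Set

_⟶_ : TSet → TSet → TSet
(K ⟶ L) t = 𝒯 t × (∀ u → K u → L (app t (arg u)))

_⊓_ : TSet → TSet → TSet
(K ⊓ L) t = 𝒯 t × L' × R'
  where L' = K (app t proj1)
        R' = L (app t proj2)

_⊔_ : TSet → TSet → TSet
(K ⊔ L) t = 𝒯 t × (∀ u v → 𝒩 u → 𝒩 v →
                    (∀ r → K r → 𝒩 (u [0:= r ])) →
                    (∀ s → L s → 𝒩 (v [0:= s ])) →
                    𝒩 (app t (case u v)))

data ℛ : TSet → Set₁ where
  rN   : ℛ 𝒩
  rArr : ∀ {K L} → ℛ K → ℛ L → ℛ (K ⟶ L)
  rAnd : ∀ {K L} → ℛ K → ℛ L → ℛ (K ⊓ L)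
  rOr  : ∀ {K L} → ℛ K → ℛ L → ℛ (K ⊔ L)

-- Every candidate is built from 𝒩 by ⟶, ⊓ and ⊔, so it suffices that 𝒩 is
-- closed under reduction and that the three operations preserve this
-- closure. For 𝒩 the two halves are subject reduction (typability is kept)
-- and the fact that the reducts of a strongly normalisable term are again
-- strongly normalisable. For K ⟶ L and K ⊓ L a reduction t ▷* t' lifts to
-- (t ε) ▷* (t' ε) inside the defining eliminations; K ⊔ L is defined through
-- 𝒩 alone, whatever K and L are.
module Submission where

open import Defs
open import Data.Nat using (ℕ; zero; suc; _≟_)
open import Data.List using (List; _∷_)
open import Data.Product using (_,_)
open import Relation.Nullary using (yes; no; ¬_; contradiction)
open import Relation.Binary.PropositionalEquality using (_≡_; refl; subst; cong)
open import Relation.Binary.Construct.Closure.ReflexiveTransitive using (ε; _◅_; gmap)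
open import Function using (id)

Renaming : List Type → List Type → (ℕ → ℕ) → Set
Renaming Γ Γ' ρ = ∀ {x A} → Γ ∋ x ∶ A → Γ' ∋ ρ x ∶ A

ext-Renaming : ∀ {Γ Γ' ρ B} → Renaming Γ Γ' ρ → Renaming (B ∷ Γ) (B ∷ Γ') (ext ρ)
ext-Renaming ρ-ok here      = here
ext-Renaming ρ-ok (there p) = there (ρ-ok p)

mutual
  ren-preserves-⊢ : ∀ {Γ Γ' Δ Δ' ρ σ t A} → Renaming Γ Γ' ρ → Renaming Δ Δ' σ →
                    Γ ∣ Δ ⊢ t ∶ A → Γ' ∣ Δ' ⊢ ren ρ σ t ∶ A
  ren-preserves-⊢ ρ-ok σ-ok (tvar p)     = tvar (ρ-ok p)
  ren-preserves-⊢ ρ-ok σ-ok (tlam d)     = tlam (ren-preserves-⊢ (ext-Renaming ρ-ok) σ-ok d)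
  ren-preserves-⊢ ρ-ok σ-ok (tapp d e)   = tapp (ren-preserves-⊢ ρ-ok σ-ok d) (renE-preserves-⊢ ρ-ok σ-ok e)
  ren-preserves-⊢ ρ-ok σ-ok (tpair d d') = tpair (ren-preserves-⊢ ρ-ok σ-ok d) (ren-preserves-⊢ ρ-ok σ-ok d')
  ren-preserves-⊢ ρ-ok σ-ok (tinl d)     = tinl (ren-preserves-⊢ ρ-ok σ-ok d)
  ren-preserves-⊢ ρ-ok σ-ok (tinr d)     = tinr (ren-preserves-⊢ ρ-ok σ-ok d)
  ren-preserves-⊢ ρ-ok σ-ok (tmu d)      = tmu (ren-preserves-⊢ ρ-ok (ext-Renaming σ-ok) d)
  ren-preserves-⊢ ρ-ok σ-ok (tnam p d)   = tnam (σ-ok p) (ren-preserves-⊢ ρ-ok σ-ok d)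

  renE-preserves-⊢ : ∀ {Γ Γ' Δ Δ' ρ σ e A B} → Renaming Γ Γ' ρ → Renaming Δ Δ' σ →
                     Γ ∣ Δ ⊢E A ▹ e ∶ B → Γ' ∣ Δ' ⊢E A ▹ renE ρ σ e ∶ B
  renE-preserves-⊢ ρ-ok σ-ok (targ d)     = targ (ren-preserves-⊢ ρ-ok σ-ok d)
  renE-preserves-⊢ ρ-ok σ-ok tproj1       = tproj1
  renE-preserves-⊢ ρ-ok σ-ok tproj2       = tproj2
  renE-preserves-⊢ ρ-ok σ-ok (tcase d d') =
    tcase (ren-preserves-⊢ (ext-Renaming ρ-ok) σ-ok d) (ren-preserves-⊢ (ext-Renaming ρ-ok) σ-ok d')

weakenλE : ∀ {Γ Δ e A B C} → Γ ∣ Δ ⊢E A ▹ e ∶ B → (C ∷ Γ) ∣ Δ ⊢E A ▹ renE suc id e ∶ B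
weakenλE = renE-preserves-⊢ there id

weakenμE : ∀ {Γ Δ e A B C} → Γ ∣ Δ ⊢E A ▹ e ∶ B → Γ ∣ (C ∷ Δ) ⊢E A ▹ renE id suc e ∶ B
weakenμE = renE-preserves-⊢ id there

Substitution : List Type → List Type → List Type → (ℕ → Term) → Set
Substitution Γ Γ' Δ s = ∀ {x A} → Γ ∋ x ∶ A → Γ' ∣ Δ ⊢ s x ∶ A

exts-Substitution : ∀ {Γ Γ' Δ s B} → Substitution Γ Γ' Δ s →
                    Substitution (B ∷ Γ) (B ∷ Γ') Δ (exts s)
exts-Substitution s-ok here      = tvar here
exts-Substitution s-ok (there p) = ren-preserves-⊢ there id (s-ok p)

mshift-Substitution : ∀ {Γ Γ' Δ s B} → Substitution Γ Γ' Δ s →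
                      Substitution Γ Γ' (B ∷ Δ) (mshift s)
mshift-Substitution s-ok p = ren-preserves-⊢ id there (s-ok p)

mutual
  sub-preserves-⊢ : ∀ {Γ Γ' Δ s t A} → Substitution Γ Γ' Δ s →
                    Γ ∣ Δ ⊢ t ∶ A → Γ' ∣ Δ ⊢ sub s t ∶ A
  sub-preserves-⊢ s-ok (tvar p)     = s-ok p
  sub-preserves-⊢ s-ok (tlam d)     = tlam (sub-preserves-⊢ (exts-Substitution s-ok) d)
  sub-preserves-⊢ s-ok (tapp d e)   = tapp (sub-preserves-⊢ s-ok d) (subE-preserves-⊢ s-ok e)
  sub-preserves-⊢ s-ok (tpair d d') = tpair (sub-preserves-⊢ s-ok d) (sub-preserves-⊢ s-ok d')
  sub-preserves-⊢ s-ok (tinl d)     = tinl (sub-preserves-⊢ s-ok d)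
  sub-preserves-⊢ s-ok (tinr d)     = tinr (sub-preserves-⊢ s-ok d)
  sub-preserves-⊢ s-ok (tmu d)      = tmu (sub-preserves-⊢ (mshift-Substitution s-ok) d)
  sub-preserves-⊢ s-ok (tnam p d)   = tnam p (sub-preserves-⊢ s-ok d)

  subE-preserves-⊢ : ∀ {Γ Γ' Δ s e A B} → Substitution Γ Γ' Δ s →
                     Γ ∣ Δ ⊢E A ▹ e ∶ B → Γ' ∣ Δ ⊢E A ▹ subE s e ∶ B
  subE-preserves-⊢ s-ok (targ d)     = targ (sub-preserves-⊢ s-ok d)
  subE-preserves-⊢ s-ok tproj1       = tproj1
  subE-preserves-⊢ s-ok tproj2       = tproj2
  subE-preserves-⊢ s-ok (tcase d d') =
    tcase (sub-preserves-⊢ (exts-Substitution s-ok) d) (sub-preserves-⊢ (exts-Substitution s-ok) d')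

single-Substitution : ∀ {Γ Δ v A} → Γ ∣ Δ ⊢ v ∶ A → Substitution (A ∷ Γ) Γ Δ (single v)
single-Substitution dv here      = dv
single-Substitution dv (there p) = tvar p

[0:=]-preserves-⊢ : ∀ {Γ Δ u v A B} → (A ∷ Γ) ∣ Δ ⊢ u ∶ B → Γ ∣ Δ ⊢ v ∶ A →
                    Γ ∣ Δ ⊢ u [0:= v ] ∶ B
[0:=]-preserves-⊢ du dv = sub-preserves-⊢ (single-Substitution dv) du

-- The μ-contexts before and after t[a:=* ε] with ε : A ▹ B: the name a is
-- retyped from A to B and every other name keeps its type.
record Retyping (Δ Δ' : List Type) (a : ℕ) (A B : Type) : Set where
  field
    old    : ∀ {X} → Δ ∋ a ∶ X → X ≡ A
    new    : Δ' ∋ a ∶ B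
    others : ∀ {b X} → ¬ b ≡ a → Δ ∋ b ∶ X → Δ' ∋ b ∶ X
open Retyping

suc-Retyping : ∀ {Δ Δ' a A B C} → Retyping Δ Δ' a A B → Retyping (C ∷ Δ) (C ∷ Δ') (suc a) A B
suc-Retyping r .old (there p)      = old r p
suc-Retyping r .new                = there (new r)
suc-Retyping r .others b≢a here      = here
suc-Retyping r .others b≢a (there p) = there (others r (λ eq → b≢a (cong suc eq)) p)

zero-Retyping : ∀ {Δ A B} → Retyping (A ∷ Δ) (B ∷ Δ) zero A B
zero-Retyping .old here             = refl
zero-Retyping .new                  = here
zero-Retyping .others b≢0 here      = contradiction refl b≢0
zero-Retyping .others b≢0 (there p) = there p

mutual
  msub-preserves-⊢ : ∀ {Γ Δ Δ' a A B e t C} → Retyping Δ Δ' a A B → Γ ∣ Δ' ⊢E A ▹ e ∶ B →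
                     Γ ∣ Δ ⊢ t ∶ C → Γ ∣ Δ' ⊢ msub a e t ∶ C
  msub-preserves-⊢ r de (tvar p)     = tvar p
  msub-preserves-⊢ r de (tlam d)     = tlam (msub-preserves-⊢ r (weakenλE de) d)
  msub-preserves-⊢ r de (tapp d f)   = tapp (msub-preserves-⊢ r de d) (msubE-preserves-⊢ r de f)
  msub-preserves-⊢ r de (tpair d d') = tpair (msub-preserves-⊢ r de d) (msub-preserves-⊢ r de d')
  msub-preserves-⊢ r de (tinl d)     = tinl (msub-preserves-⊢ r de d)
  msub-preserves-⊢ r de (tinr d)     = tinr (msub-preserves-⊢ r de d)
  msub-preserves-⊢ r de (tmu d)      = tmu (msub-preserves-⊢ (suc-Retyping r) (weakenμE de) d)
  msub-preserves-⊢ {a = a} r de (tnam {a = b} p d) with b ≟ a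
  ... | yes refl = tnam (new r) (tapp (subst (_ ∣ _ ⊢ _ ∶_) (old r p) (msub-preserves-⊢ r de d)) de)
  ... | no b≢a   = tnam (others r b≢a p) (msub-preserves-⊢ r de d)

  msubE-preserves-⊢ : ∀ {Γ Δ Δ' a A B e f C D} → Retyping Δ Δ' a A B → Γ ∣ Δ' ⊢E A ▹ e ∶ B →
                      Γ ∣ Δ ⊢E C ▹ f ∶ D → Γ ∣ Δ' ⊢E C ▹ msubE a e f ∶ D
  msubE-preserves-⊢ r de (targ d)     = targ (msub-preserves-⊢ r de d)
  msubE-preserves-⊢ r de tproj1       = tproj1
  msubE-preserves-⊢ r de tproj2       = tproj2
  msubE-preserves-⊢ r de (tcase d d') =
    tcase (msub-preserves-⊢ r (weakenλE de) d) (msub-preserves-⊢ r (weakenλE de) d')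

mutual
  subject-reduction : ∀ {Γ Δ t t' A} → Γ ∣ Δ ⊢ t ∶ A → t ▷ t' → Γ ∣ Δ ⊢ t' ∶ A
  subject-reduction (tapp (tlam d) (targ d'))       β   = [0:=]-preserves-⊢ d d'
  subject-reduction (tapp (tpair d d') tproj1)      π₁β = d
  subject-reduction (tapp (tpair d d') tproj2)      π₂β = d'
  subject-reduction (tapp (tinl d) (tcase d₁ d₂))   ω₁β = [0:=]-preserves-⊢ d₁ d
  subject-reduction (tapp (tinr d) (tcase d₁ d₂))   ω₂β = [0:=]-preserves-⊢ d₂ d
  subject-reduction (tapp (tapp d (tcase d₁ d₂)) de) comm =
    tapp d (tcase (tapp d₁ (weakenλE de)) (tapp d₂ (weakenλE de)))
  subject-reduction (tapp (tmu d) de) μβ = tmu (msub-preserves-⊢ zero-Retyping (weakenμE de) d)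
  subject-reduction (tlam d)     (ξlam r)   = tlam (subject-reduction d r)
  subject-reduction (tapp d e)   (ξappl r)  = tapp (subject-reduction d r) e
  subject-reduction (tapp d e)   (ξappr r)  = tapp d (subject-reductionE e r)
  subject-reduction (tpair d d') (ξpairl r) = tpair (subject-reduction d r) d'
  subject-reduction (tpair d d') (ξpairr r) = tpair d (subject-reduction d' r)
  subject-reduction (tinl d)     (ξinl r)   = tinl (subject-reduction d r)
  subject-reduction (tinr d)     (ξinr r)   = tinr (subject-reduction d r)
  subject-reduction (tmu d)      (ξmu r)    = tmu (subject-reduction d r)
  subject-reduction (tnam p d)   (ξnam r)   = tnam p (subject-reduction d r)

  subject-reductionE : ∀ {Γ Δ e e' A B} → Γ ∣ Δ ⊢E A ▹ e ∶ B → e ▷E e' → Γ ∣ Δ ⊢E A ▹ e' ∶ B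
  subject-reductionE (targ d)     (ξarg r)   = targ (subject-reduction d r)
  subject-reductionE (tcase d d') (ξcasel r) = tcase (subject-reduction d r) d'
  subject-reductionE (tcase d d') (ξcaser r) = tcase d (subject-reduction d' r)

ReductClosed : TSet → Set
ReductClosed R = ∀ {t t'} → R t → t ▷* t' → R t'

𝒯-reductClosed : ReductClosed 𝒯
𝒯-reductClosed ty                 ε        = ty
𝒯-reductClosed (Γ , Δ , A , d) (r ◅ rs) = 𝒯-reductClosed (Γ , Δ , A , subject-reduction d r) rs

SN-reductClosed : ReductClosed SN
SN-reductClosed s        ε        = s
SN-reductClosed (sn acc) (r ◅ rs) = SN-reductClosed (acc r) rs

𝒩-reductClosed : ReductClosed 𝒩
𝒩-reductClosed (ty , s) rs = 𝒯-reductClosed ty rs , SN-reductClosed s rs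

app-▷*ˡ : ∀ {t t'} e → t ▷* t' → app t e ▷* app t' e
app-▷*ˡ e = gmap (λ t → app t e) ξappl

⟶-reductClosed : ∀ {K L} → ReductClosed L → ReductClosed (K ⟶ L)
⟶-reductClosed L-closed (ty , tK⊆L) rs =
  𝒯-reductClosed ty rs , λ u u∈K → L-closed (tK⊆L u u∈K) (app-▷*ˡ (arg u) rs)

⊓-reductClosed : ∀ {K L} → ReductClosed K → ReductClosed L → ReductClosed (K ⊓ L)
⊓-reductClosed K-closed L-closed (ty , t₁∈K , t₂∈L) rs =
  𝒯-reductClosed ty rs , K-closed t₁∈K (app-▷*ˡ proj1 rs) , L-closed t₂∈L (app-▷*ˡ proj2 rs)

⊔-reductClosed : ∀ {K L} → ReductClosed (K ⊔ L)
⊔-reductClosed (ty , cases∈𝒩) rs =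
  𝒯-reductClosed ty rs ,
  λ u v u∈𝒩 v∈𝒩 u[K]∈𝒩 v[L]∈𝒩 →
    𝒩-reductClosed (cases∈𝒩 u v u∈𝒩 v∈𝒩 u[K]∈𝒩 v[L]∈𝒩) (app-▷*ˡ (case u v) rs)

ℛ-reductClosed : ∀ {R} → ℛ R → ReductClosed R
ℛ-reductClosed rN         = 𝒩-reductClosed
ℛ-reductClosed (rArr K L) = ⟶-reductClosed (ℛ-reductClosed L)
ℛ-reductClosed (rAnd K L) = ⊓-reductClosed (ℛ-reductClosed K) (ℛ-reductClosed L)
ℛ-reductClosed (rOr K L)  = ⊔-reductClosed

mainTheorem7 : ∀ {R : TSet} → ℛ R → ∀ t t' → R t → t ▷* t' → R t'
mainTheorem7 R∈ℛ t t' = ℛ-reductClosed R∈ℛ
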